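{- Let $q$ be an odd prime power, let $H=\{(1,s^4,s^2)\mid s\in\mathbb{F}_q\}$, a subset of the conic $XY-Z^2=0$ of $\mathrm{PG}(2,q)$, let $R_0=(a_0,b_0,0)$ with $a_0,b_0\in\mathbb{F}_q\setminus\{0\}$, and let $K=H\cup\{R_0\}$. If $q\equiv 1\pmod 4$, then the point $(0,0,1)$ is $H$-covered. If $q\equiv 3\pmod 4$ and $b_0/a_0\in\{u^4 : u\in\mathbb{F}_q\setminus\{0\}\}$, then the point $(0,0,1)$ is $K$-covered.
   Context: $\mathrm{PG}(2,q)$ is the projective plane over the finite field $\mathbb{F}_q$, points in homogeneous coordinates. For a set of points $S$, a point of $\mathrm{PG}(2,q)\setminus S$ is called $S$-covered if it lies on a line joining two distinct points of $S$, and $S$-free otherwise. -}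

module Defs where

open import Level using (Level; _⊔_) renaming (suc to lsuc)
open import Algebra.Bundles using (CommutativeRing)
open import Data.Nat using (ℕ; suc; _^_; _%_)
open import Data.Nat.Primality using (Prime)
open import Data.Fin using (Fin)
open import Data.Product using (Σ; ∃; _×_; _,_; proj₁)
open import Data.Sum using (_⊎_)
open import Relation.Nullary using (¬_; Dec)
open import Relation.Binary.PropositionalEquality using (_≡_)

OddPrimePower : ℕ → Set
OddPrimePower q = Σ ℕ λ p → Σ ℕ λ n → Prime p × q ≡ p ^ suc n × q % 2 ≡ 1

record FiniteField (c ℓ : Level) (q : ℕ) : Set (lsuc (c ⊔ ℓ)) where
  field
    commRing : CommutativeRing c ℓ
  open CommutativeRing commRing public
  field
    _≟_     : (x y : Carrier) → Dec (x ≈ y)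
    1≉0     : ¬ (1# ≈ 0#)
    inverse : (x : Carrier) → ¬ (x ≈ 0#) → Σ Carrier λ y → x * y ≈ 1#
    enum    : Fin q → Carrier
    enum-surj : (x : Carrier) → Σ (Fin q) λ i → enum i ≈ x
    enum-inj  : (i j : Fin q) → enum i ≈ enum j → i ≡ j

module Projective {c ℓ : Level} {q : ℕ} (F : FiniteField c ℓ q) where
  open FiniteField F

  div : Carrier → (y : Carrier) → ¬ (y ≈ 0#) → Carrier
  div x y y≉0 = x * proj₁ (inverse y y≉0)

  Triple : Set c
  Triple = Carrier × Carrier × Carrier

  _≈₃_ : Triple → Triple → Set ℓ
  (x₁ , y₁ , z₁) ≈₃ (x₂ , y₂ , z₂) = x₁ ≈ x₂ × y₁ ≈ y₂ × z₁ ≈ z₂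

  -- a triple represents a point of PG(2,q) iff it is nonzero
  NonZero₃ : Triple → Set ℓ
  NonZero₃ (x , y , z) = ¬ (x ≈ 0# × y ≈ 0# × z ≈ 0#)

  SamePoint : Triple → Triple → Set (c ⊔ ℓ)
  SamePoint (x₁ , y₁ , z₁) (x₂ , y₂ , z₂) =
    Σ Carrier λ t → ¬ (t ≈ 0#) × (x₂ ≈ t * x₁ × y₂ ≈ t * y₁ × z₂ ≈ t * z₁)

  det : Triple → Triple → Triple → Carrier
  det (a₁ , a₂ , a₃) (b₁ , b₂ , b₃) (c₁ , c₂ , c₃) =
    a₁ * (b₂ * c₃ - b₃ * c₂) - a₂ * (b₁ * c₃ - b₃ * c₁) + a₃ * (b₁ * c₂ - b₂ * c₁)

  Collinear : Triple → Triple → Triple → Set ℓ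
  Collinear P Q R = det P Q R ≈ 0#

  PointSet : (ℓ' : Level) → Set (c ⊔ lsuc ℓ')
  PointSet ℓ' = Triple → Set ℓ'

  _∈P_ : {ℓ' : Level} → Triple → PointSet ℓ' → Set (c ⊔ ℓ ⊔ ℓ')
  P ∈P S = Σ Triple λ A → S A × SamePoint A P

  Covered : {ℓ' : Level} → PointSet ℓ' → Triple → Set (c ⊔ ℓ ⊔ ℓ')
  Covered S P =
    NonZero₃ P × ¬ (P ∈P S) ×
    Σ Triple λ A → Σ Triple λ B →
      S A × S B × ¬ (SamePoint A B) × Collinear A B P

  sq : Carrier → Carrier
  sq x = x * x

  H : PointSet (c ⊔ ℓ)
  H P = Σ Carrier λ s → P ≈₃ (1# , sq (sq s) , sq s)

  K : Triple → PointSet (c ⊔ ℓ)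
  K R₀ P = H P ⊎ P ≈₃ R₀

-- If s² = −1, then (1, s⁴, s²) = (1, 1, −1) and (1, 1, 1) are points of H whose
-- join X = Y passes through (0, 0, 1); and R₀, (1, u⁴, u²), (0, 0, 1) are collinear
-- as soon as a₀ u⁴ = b₀. The substance is that −1 is a square in F_q when
-- q ≡ 1 (mod 4), which follows by counting with two commuting involutions.
-- Negation fixes only 0, so q = 1 + 2m where m is the number of pairs {x, −x}.
-- Inversion permutes these pairs; it fixes the pair {1, −1}, and any other pair it
-- fixes consists of square roots of −1. Without such roots the remaining pairs
-- are swapped two by two, so m is odd and q ≡ 3 (mod 4).
module Submission where

open import Defs
open import Level using (Level)
open import Data.Nat using (ℕ; _%_)
open import Data.Product using (Σ; _×_; _,_)
open import Relation.Nullary using (¬_)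
open import Relation.Binary.PropositionalEquality using (_≡_)

module InvolutionCounting where

  open import Data.Bool.Base using (Bool; true; false; not; if_then_else_)
  import Data.Bool.Properties as Bool
  open import Data.Fin.Base using (Fin; punchIn)
  open import Data.Fin.Permutation using (Permutation; permutation)
  open import Data.Fin.Properties using (_≟_; _<?_; <-cmp; <-irrefl; punchInᵢ≢i)
  open import Data.Nat.Base using (ℕ; zero; suc; _+_; _*_)
  open import Data.Nat.Properties using (+-0-commutativeMonoid; +-identityʳ; *-comm)
  open import Data.Nat.Tactic.RingSolver using (solve-∀)
  open import Data.Product using (∃-syntax; _,_)
  open import Data.Sum using (_⊎_; inj₁; inj₂; [_,_])
  open import Function.Base using (_∘_; const)
  open import Relation.Binary.Definitions using (tri<; tri≈; tri>)
  open import Relation.Binary.PropositionalEquality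
    using (_≡_; _≢_; refl; sym; trans; cong; cong₂; subst; module ≡-Reasoning)
  open import Relation.Nullary using (does; yes; no)
  open import Relation.Nullary.Decidable using (dec-true; dec-false)
  open import Relation.Nullary.Negation using (contradiction)
  open import Algebra.Properties.CommutativeMonoid.Sum +-0-commutativeMonoid
    using (sum; sum-cong-≗; ∑-distrib-+; sum-permute; sum-remove; sum-replicate-zero)

  sum-const-1 : ∀ n → sum {n} (const 1) ≡ n
  sum-const-1 zero    = refl
  sum-const-1 (suc n) = cong suc (sum-const-1 n)

  sum-supported-at : ∀ {n} (w : Fin n → ℕ) k → (∀ i → i ≢ k → w i ≡ 0) → sum w ≡ w k
  sum-supported-at {suc n} w k w-vanishes = begin
    sum w                                 ≡⟨ sum-remove w ⟩
    w k + sum (λ j → w (punchIn k j))     ≡⟨ cong (w k +_) (sum-cong-≗ (λ j → w-vanishes _ (punchInᵢ≢i k j))) ⟩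
    w k + sum {n} (λ _ → 0)               ≡⟨ cong (w k +_) (sum-replicate-zero n) ⟩
    w k + 0                               ≡⟨ +-identityʳ (w k) ⟩
    w k                                   ∎
    where open ≡-Reasoning

  split-by-order : ∀ {n} (i j : Fin n) x →
    x ≡ (if does (i <? j) then x else 0) + (if does (j ≟ i) then x else 0) + (if does (j <? i) then x else 0)
  split-by-order i j x with <-cmp i j
  ... | tri< i<j i≢j j≮i
    rewrite dec-true (i <? j) i<j | dec-false (j ≟ i) (i≢j ∘ sym) | dec-false (j <? i) j≮i
    = sym (trans (+-identityʳ (x + 0)) (+-identityʳ x))
  ... | tri≈ i≮j i≡j j≮i
    rewrite dec-false (i <? j) i≮j | dec-true (j ≟ i) (sym i≡j) | dec-false (j <? i) j≮i
    = sym (+-identityʳ x)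
  ... | tri> i≮j i≢j j<i
    rewrite dec-false (i <? j) i≮j | dec-false (j ≟ i) (i≢j ∘ sym) | dec-true (j <? i) j<i
    = refl

  module Involution {n : ℕ} (σ : Fin n → Fin n) (σ-involutive : ∀ i → σ (σ i) ≡ i) where

    -- A σ-orbit {i, σ i} of size two is represented by its point of smaller
    -- index; lowerPart w is w restricted to these representatives.
    isLower : Fin n → Bool
    isLower i = does (i <? σ i)

    lowerPart : (Fin n → ℕ) → Fin n → ℕ
    lowerPart w i = if isLower i then w i else 0

    fixedPart : (Fin n → ℕ) → Fin n → ℕ
    fixedPart w i = if does (σ i ≟ i) then w i else 0

    σ-permutation : Permutation n n
    σ-permutation = permutation σ σ σ-involutive σ-involutive

    sum-involution : ∀ w → (∀ i → w (σ i) ≡ w i) →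
      sum w ≡ sum (fixedPart w) + 2 * sum (lowerPart w)
    sum-involution w w-σ = begin
      sum w                                                      ≡⟨ sum-cong-≗ split ⟩
      sum (λ i → lowerPart w i + fixedPart w i + lowerPart w (σ i))
        ≡⟨ trans (∑-distrib-+ (λ i → lowerPart w i + fixedPart w i) (lowerPart w ∘ σ))
                 (cong (_+ sum (lowerPart w ∘ σ)) (∑-distrib-+ (lowerPart w) (fixedPart w))) ⟩
      sum (lowerPart w) + sum (fixedPart w) + sum (lowerPart w ∘ σ)
        ≡⟨ cong (sum (lowerPart w) + sum (fixedPart w) +_) (sum-permute (lowerPart w) σ-permutation) ⟨
      sum (lowerPart w) + sum (fixedPart w) + sum (lowerPart w)  ≡⟨ rearrange (sum (lowerPart w)) (sum (fixedPart w)) ⟩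
      sum (fixedPart w) + 2 * sum (lowerPart w)                  ∎
      where
      open ≡-Reasoning
      rearrange : ∀ a b → a + b + a ≡ b + 2 * a
      rearrange = solve-∀
      split : ∀ i → w i ≡ lowerPart w i + fixedPart w i + lowerPart w (σ i)
      split i = trans (split-by-order i (σ i) (w i))
        (cong (lowerPart w i + fixedPart w i +_)
              (cong₂ (λ j x → if does (σ i <? j) then x else 0) (sym (σ-involutive i)) (sym (w-σ i))))

    sum-fixedPart-single : ∀ w z → σ z ≡ z → (∀ i → σ i ≡ i → i ≡ z) → sum (fixedPart w) ≡ w z
    sum-fixedPart-single w z σz≡z only-z = trans (sum-supported-at (fixedPart w) z off-z)
      (cong (if_then w z else 0) (dec-true (σ z ≟ z) σz≡z))
      where
      off-z : ∀ i → i ≢ z → fixedPart w i ≡ 0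
      off-z i i≢z = cong (if_then w i else 0) (dec-false (σ i ≟ i) (i≢z ∘ only-z i))

    sum-fixedPart-free : ∀ w → (∀ i → σ i ≢ i) → sum (fixedPart w) ≡ 0
    sum-fixedPart-free w free = trans
      (sum-cong-≗ (λ i → cong (if_then w i else 0) (dec-false (σ i ≟ i) (free i))))
      (sum-replicate-zero n)

    size≡fixed+2*pairs : n ≡ sum (fixedPart (const 1)) + 2 * sum (lowerPart (const 1))
    size≡fixed+2*pairs = trans (sym (sum-const-1 n)) (sum-involution (const 1) (λ _ → refl))

    size-even : (∀ i → σ i ≢ i) → ∃[ m ] n ≡ m * 2
    size-even free = sum (lowerPart (const 1)) , trans size≡fixed+2*pairs
      (trans (cong (_+ 2 * sum (lowerPart (const 1))) (sum-fixedPart-free (const 1) free))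
             (*-comm 2 (sum (lowerPart (const 1)))))

    isLower-fixed : ∀ {i} → σ i ≡ i → isLower i ≡ false
    isLower-fixed {i} σi≡i = dec-false (i <? σ i) (<-irrefl (sym σi≡i))

    isLower-σ : ∀ i → σ i ≢ i → isLower (σ i) ≡ not (isLower i)
    isLower-σ i σi≢i rewrite σ-involutive i with <-cmp i (σ i)
    ... | tri< i<σi _ σi≮i = trans (dec-false (σ i <? i) σi≮i) (cong not (sym (dec-true (i <? σ i) i<σi)))
    ... | tri≈ _ i≡σi _    = contradiction (sym i≡σi) σi≢i
    ... | tri> i≮σi _ σi<i = trans (dec-true (σ i <? i) σi<i) (cong not (sym (dec-false (i <? σ i) i≮σi)))

    lower⇒moved : ∀ {i} → isLower i ≡ true → σ i ≢ i
    lower⇒moved lower-i σi≡i with () ← trans (sym lower-i) (isLower-fixed σi≡i)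

    lowerOf : Fin n → Fin n
    lowerOf a = if isLower a then a else σ a

    isLower-lowerOf : ∀ a → σ a ≢ a → isLower (lowerOf a) ≡ true
    isLower-lowerOf a σa≢a with isLower a in lower-a
    ... | true  = lower-a
    ... | false = trans (isLower-σ a σa≢a) (cong not lower-a)

    lowerOf-unique : ∀ {i a} → isLower i ≡ true → i ≡ a ⊎ i ≡ σ a → i ≡ lowerOf a
    lowerOf-unique {i} lower-i (inj₁ refl) = sym (cong (if_then i else σ i) lower-i)
    lowerOf-unique {i} {a} lower-i (inj₂ refl) = sym (cong (if_then a else σ a) a-upper)
      where
      open ≡-Reasoning
      a-upper : isLower a ≡ false
      a-upper = begin
        isLower a            ≡⟨ cong isLower (σ-involutive a) ⟨
        isLower (σ (σ a))    ≡⟨ isLower-σ (σ a) (lower⇒moved lower-i) ⟩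
        not (isLower (σ a))  ≡⟨ cong not lower-i ⟩
        false                ∎

    lowerOf-cases : ∀ a → lowerOf a ≡ a ⊎ lowerOf a ≡ σ a
    lowerOf-cases a with isLower a
    ... | true  = inj₁ refl
    ... | false = inj₂ refl

  module CommutingInvolutions {n : ℕ} (σ τ : Fin n → Fin n)
    (σ-involutive : ∀ i → σ (σ i) ≡ i) (τ-involutive : ∀ i → τ (τ i) ≡ i)
    (σ-τ-commute : ∀ i → σ (τ i) ≡ τ (σ i)) where

    open Involution σ σ-involutive

    -- τ permutes the σ-orbits; onLower is that action read off on representatives:
    -- of the two points τ i and σ (τ i) it picks the one on the same side as i.
    onLower : Fin n → Fin n
    onLower i = if does (isLower (τ i) Bool.≟ isLower i) then τ i else σ (τ i)

    side : ∀ i → isLower (τ i) ≡ isLower i ⊎ isLower (τ i) ≡ not (isLower i)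
    side i with isLower (τ i) Bool.≟ isLower i
    ... | yes same   = inj₁ same
    ... | no differ = inj₂ (Bool.¬-not differ)

    onLower-same : ∀ {i} → isLower (τ i) ≡ isLower i → onLower i ≡ τ i
    onLower-same {i} same = cong (if_then τ i else σ (τ i)) (dec-true (isLower (τ i) Bool.≟ isLower i) same)

    onLower-differ : ∀ {i} → isLower (τ i) ≡ not (isLower i) → onLower i ≡ σ (τ i)
    onLower-differ {i} differ = cong (if_then τ i else σ (τ i))
      (dec-false (isLower (τ i) Bool.≟ isLower i) (λ same → Bool.not-¬ refl (trans (sym same) differ)))

    σ-fixed-τ : ∀ {i} → σ i ≡ i → σ (τ i) ≡ τ i
    σ-fixed-τ {i} σi≡i = trans (σ-τ-commute i) (cong τ σi≡i)

    σ-fixed-τ⁻¹ : ∀ {i} → σ (τ i) ≡ τ i → σ i ≡ i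
    σ-fixed-τ⁻¹ {i} στi≡τi = subst (λ j → σ j ≡ j) (τ-involutive i) (σ-fixed-τ στi≡τi)

    differ⇒τ-moved : ∀ {i} → isLower (τ i) ≡ not (isLower i) → σ (τ i) ≢ τ i
    differ⇒τ-moved {i} differ στi≡τi with () ←
      trans (sym (isLower-fixed στi≡τi)) (trans differ (cong not (isLower-fixed (σ-fixed-τ⁻¹ στi≡τi))))

    isLower-onLower : ∀ i → isLower (onLower i) ≡ isLower i
    isLower-onLower i with side i
    ... | inj₁ same   = trans (cong isLower (onLower-same same)) same
    ... | inj₂ differ = begin
      isLower (onLower i)      ≡⟨ cong isLower (onLower-differ differ) ⟩
      isLower (σ (τ i))        ≡⟨ isLower-σ (τ i) (differ⇒τ-moved differ) ⟩
      not (isLower (τ i))      ≡⟨ cong not differ ⟩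
      not (not (isLower i))    ≡⟨ Bool.not-involutive (isLower i) ⟩
      isLower i                ∎
      where open ≡-Reasoning

    onLower-involutive : ∀ i → onLower (onLower i) ≡ i
    onLower-involutive i with side i
    ... | inj₁ same = begin
      onLower (onLower i)  ≡⟨ cong onLower (onLower-same same) ⟩
      onLower (τ i)        ≡⟨ onLower-same (trans (cong isLower (τ-involutive i)) (sym same)) ⟩
      τ (τ i)              ≡⟨ τ-involutive i ⟩
      i                    ∎
      where open ≡-Reasoning
    ... | inj₂ differ = begin
      onLower (onLower i)      ≡⟨ cong onLower (onLower-differ differ) ⟩
      onLower (σ (τ i))        ≡⟨ onLower-differ side-flips ⟩
      σ (τ (σ (τ i)))          ≡⟨ cong σ τστi≡σi ⟩
      σ (σ i)                  ≡⟨ σ-involutive i ⟩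
      i                        ∎
      where
      open ≡-Reasoning
      τστi≡σi : τ (σ (τ i)) ≡ σ i
      τστi≡σi = trans (cong τ (σ-τ-commute i)) (τ-involutive (σ i))
      side-flips : isLower (τ (σ (τ i))) ≡ not (isLower (σ (τ i)))
      side-flips = begin
        isLower (τ (σ (τ i)))    ≡⟨ cong isLower τστi≡σi ⟩
        isLower (σ i)            ≡⟨ isLower-σ i (differ⇒τ-moved differ ∘ σ-fixed-τ) ⟩
        not (isLower i)          ≡⟨ cong not (isLower-onLower i) ⟨
        not (isLower (onLower i)) ≡⟨ cong (not ∘ isLower) (onLower-differ differ) ⟩
        not (isLower (σ (τ i)))  ∎

    onLower-cases : ∀ i → onLower i ≡ τ i ⊎ onLower i ≡ σ (τ i)
    onLower-cases i with side i
    ... | inj₁ same   = inj₁ (onLower-same same)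
    ... | inj₂ differ = inj₂ (onLower-differ differ)

    lowerPart-onLower : ∀ w → (∀ i → w (σ i) ≡ w i) → (∀ i → w (τ i) ≡ w i) →
      ∀ i → lowerPart w (onLower i) ≡ lowerPart w i
    lowerPart-onLower w w-σ w-τ i = cong₂ (λ b x → if b then x else 0) (isLower-onLower i) w-onLower
      where
      w-onLower : w (onLower i) ≡ w i
      w-onLower with onLower-cases i
      ... | inj₁ τi   = trans (cong w τi) (w-τ i)
      ... | inj₂ στi = trans (cong w στi) (trans (w-σ (τ i)) (w-τ i))

    onLower-fixed : ∀ {i} → onLower i ≡ i → τ i ≡ i ⊎ σ (τ i) ≡ i
    onLower-fixed {i} fixed with onLower-cases i
    ... | inj₁ τi   = inj₁ (trans (sym τi) fixed)
    ... | inj₂ στi = inj₂ (trans (sym στi) fixed)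

    module OnLower = Involution onLower onLower-involutive

    τ-lowerOf : ∀ {a} → τ a ≡ a → τ (lowerOf a) ≡ lowerOf a
    τ-lowerOf {a} τa≡a with lowerOf-cases a
    ... | inj₁ k≡a  = trans (cong τ k≡a) (trans τa≡a (sym k≡a))
    ... | inj₂ k≡σa = trans (cong τ k≡σa) (trans (sym (σ-τ-commute a)) (trans (cong σ τa≡a) (sym k≡σa)))

    -- The fixed points of onLower among the lower points are the representatives
    -- of the σ-orbits that τ maps to themselves.
    sum-lowerPart-odd : ∀ a → σ a ≢ a → τ a ≡ a → (∀ i → σ i ≢ i → τ i ≡ i → i ≡ a ⊎ i ≡ σ a) →
      (∀ i → σ i ≢ i → σ (τ i) ≢ i) →
      sum (lowerPart (const 1)) ≡ 1 + 2 * sum (OnLower.lowerPart (lowerPart (const 1)))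
    sum-lowerPart-odd a σa≢a τa≡a τ-fixed στ-free = begin
      sum pairs
        ≡⟨ OnLower.sum-involution pairs (lowerPart-onLower (const 1) (λ _ → refl) (λ _ → refl)) ⟩
      sum (OnLower.fixedPart pairs) + 2 * sum (OnLower.lowerPart pairs)
        ≡⟨ cong (_+ 2 * sum (OnLower.lowerPart pairs)) (trans (sum-supported-at _ k off-k) at-k) ⟩
      1 + 2 * sum (OnLower.lowerPart pairs)      ∎
      where
      open ≡-Reasoning
      pairs : Fin n → ℕ
      pairs = lowerPart (const 1)

      k : Fin n
      k = lowerOf a

      at-k : OnLower.fixedPart pairs k ≡ 1
      at-k = trans (cong (if_then pairs k else 0) (dec-true (onLower k ≟ k) k-fixed))
                   (cong (if_then 1 else 0) (isLower-lowerOf a σa≢a))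
        where k-fixed = trans (onLower-same (cong isLower (τ-lowerOf τa≡a))) (τ-lowerOf τa≡a)

      lower-fixed⇒k : ∀ {i} → isLower i ≡ true → onLower i ≡ i → i ≡ k
      lower-fixed⇒k {i} lower-i fixed = [ (λ τi≡i → lowerOf-unique lower-i (τ-fixed i moved τi≡i))
                                        , (λ στi≡i → contradiction στi≡i (στ-free i moved)) ] (onLower-fixed fixed)
        where moved = lower⇒moved lower-i

      off-k : ∀ i → i ≢ k → OnLower.fixedPart pairs i ≡ 0
      off-k i i≢k with onLower i ≟ i
      ... | no _      = refl
      ... | yes fixed = cong (if_then 1 else 0) (Bool.¬-not (λ lower-i → i≢k (lower-fixed⇒k lower-i fixed)))

    size≡3-mod-4 : ∀ z a →
      σ z ≡ z → (∀ i → σ i ≡ i → i ≡ z) →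
      σ a ≢ a → τ a ≡ a → (∀ i → σ i ≢ i → τ i ≡ i → i ≡ a ⊎ i ≡ σ a) →
      (∀ i → σ i ≢ i → σ (τ i) ≢ i) →
      ∃[ m ] n ≡ 3 + m * 4
    size≡3-mod-4 z a σz≡z only-z σa≢a τa≡a τ-fixed στ-free = m , (begin
      n                                                          ≡⟨ size≡fixed+2*pairs ⟩
      sum (fixedPart (const 1)) + 2 * sum (lowerPart (const 1))
        ≡⟨ cong₂ (λ x y → x + 2 * y) (sum-fixedPart-single (const 1) z σz≡z only-z)
                                     (sum-lowerPart-odd a σa≢a τa≡a τ-fixed στ-free) ⟩
      1 + 2 * (1 + 2 * m)                                        ≡⟨ rearrange m ⟩
      3 + m * 4                                                  ∎)
      where
      open ≡-Reasoning
      m : ℕ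
      m = sum (OnLower.lowerPart (lowerPart (const 1)))
      rearrange : ∀ m → 1 + 2 * (1 + 2 * m) ≡ 3 + m * 4
      rearrange = solve-∀

module FiniteFieldFacts {c ℓ : Level} {q : ℕ} (F : FiniteField c ℓ q) where

  import Data.Nat.Base as ℕ
  open import Data.Nat.DivMod using (m*n%n≡0; [m+kn]%n≡m%n)
  open import Data.Fin.Base using (Fin)
  open import Data.Fin.Properties using (any?)
  open import Data.Product using (∃-syntax; _,_; proj₁; proj₂)
  open import Data.Sum using (_⊎_; inj₁; inj₂)
  open import Function.Base using (case_of_)
  open import Relation.Nullary using (yes; no)
  open import Relation.Nullary.Negation using (contradiction)
  open import Relation.Binary.PropositionalEquality as ≡ using (_≡_; _≢_)
  open InvolutionCounting using (module Involution; module CommutingInvolutions)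

  open FiniteField F
  open import Algebra.Definitions _≈_ using (Congruent₁; Involutive)
  open import Algebra.Properties.Ring ring
    using (-‿involutive; -0#≈0#; -‿distribˡ-*; -‿distribʳ-*; x[y-z]≈xy-xz; +-inverseˡ-unique; x∙y⁻¹≈ε⇒x≈y; +-cancelˡ)
  open import Relation.Binary.Reasoning.Setoid setoid

  x≉0∧xy≈0⇒y≈0 : ∀ {x y} → x ≉ 0# → x * y ≈ 0# → y ≈ 0#
  x≉0∧xy≈0⇒y≈0 {x} {y} x≉0 xy≈0 = begin
    y             ≈⟨ *-identityˡ y ⟨
    1# * y        ≈⟨ *-congʳ (trans (*-comm x′ x) (proj₂ (inverse x x≉0))) ⟨
    (x′ * x) * y  ≈⟨ *-assoc x′ x y ⟩
    x′ * (x * y)  ≈⟨ *-congˡ xy≈0 ⟩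
    x′ * 0#       ≈⟨ zeroʳ x′ ⟩
    0#            ∎
    where x′ = proj₁ (inverse x x≉0)

  -- Total inverse, with the junk value 0 ⁻¹ = 0.
  _⁻¹ : Carrier → Carrier
  x ⁻¹ with x ≟ 0#
  ... | yes _   = 0#
  ... | no x≉0 = proj₁ (inverse x x≉0)

  ⁻¹-inverseʳ : ∀ {x} → x ≉ 0# → x * x ⁻¹ ≈ 1#
  ⁻¹-inverseʳ {x} x≉0 with x ≟ 0#
  ... | yes x≈0  = contradiction x≈0 x≉0
  ... | no x≉0′ = proj₂ (inverse x x≉0′)

  ⁻¹-zero : ∀ {x} → x ≈ 0# → x ⁻¹ ≈ 0#
  ⁻¹-zero {x} x≈0 with x ≟ 0#
  ... | yes _    = refl
  ... | no x≉0 = contradiction x≈0 x≉0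

  inverse-unique : ∀ {x y} → x * y ≈ 1# → y ≈ x ⁻¹
  inverse-unique {x} {y} xy≈1 = begin
    y                ≈⟨ *-identityˡ y ⟨
    1# * y           ≈⟨ *-congʳ (trans (*-comm (x ⁻¹) x) (⁻¹-inverseʳ x≉0)) ⟨
    (x ⁻¹ * x) * y   ≈⟨ *-assoc (x ⁻¹) x y ⟩
    x ⁻¹ * (x * y)   ≈⟨ *-congˡ xy≈1 ⟩
    x ⁻¹ * 1#        ≈⟨ *-identityʳ (x ⁻¹) ⟩
    x ⁻¹             ∎
    where
    x≉0 : x ≉ 0#
    x≉0 x≈0 = 1≉0 (trans (sym xy≈1) (trans (*-congʳ x≈0) (zeroˡ y)))

  ⁻¹-cong : Congruent₁ _⁻¹
  ⁻¹-cong {x} {y} x≈y = case x ≟ 0# of λ where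
    (yes x≈0) → trans (⁻¹-zero x≈0) (sym (⁻¹-zero (trans (sym x≈y) x≈0)))
    (no x≉0)  → inverse-unique (trans (*-congʳ (sym x≈y)) (⁻¹-inverseʳ x≉0))

  ⁻¹-involutive : Involutive _⁻¹
  ⁻¹-involutive x = case x ≟ 0# of λ where
    (yes x≈0) → trans (⁻¹-zero (⁻¹-zero x≈0)) (sym x≈0)
    (no x≉0)  → sym (inverse-unique (trans (*-comm (x ⁻¹) x) (⁻¹-inverseʳ x≉0)))

  -x*-y≈x*y : ∀ x y → - x * - y ≈ x * y
  -x*-y≈x*y x y = begin
    - x * - y      ≈⟨ -‿distribˡ-* x (- y) ⟨
    - (x * - y)    ≈⟨ -‿cong (-‿distribʳ-* x y) ⟨
    - - (x * y)    ≈⟨ -‿involutive (x * y) ⟩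
    x * y          ∎

  -‿⁻¹ : ∀ x → (- x) ⁻¹ ≈ - (x ⁻¹)
  -‿⁻¹ x = case x ≟ 0# of λ where
    (yes x≈0) → trans (⁻¹-zero (trans (-‿cong x≈0) -0#≈0#)) (sym (trans (-‿cong (⁻¹-zero x≈0)) -0#≈0#))
    (no x≉0)  → sym (inverse-unique (trans (-x*-y≈x*y x (x ⁻¹)) (⁻¹-inverseʳ x≉0)))

  x*x≈1⇒[x+1][x-1]≈0 : ∀ {x} → x * x ≈ 1# → (x + 1#) * (x - 1#) ≈ 0#
  x*x≈1⇒[x+1][x-1]≈0 {x} x*x≈1 = begin
    (x + 1#) * (x - 1#)            ≈⟨ x[y-z]≈xy-xz (x + 1#) x 1# ⟩
    (x + 1#) * x - (x + 1#) * 1#   ≈⟨ +-cong (distribʳ x x 1#) (-‿cong (*-identityʳ (x + 1#))) ⟩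
    (x * x + 1# * x) - (x + 1#)    ≈⟨ +-congʳ (+-cong x*x≈1 (*-identityˡ x)) ⟩
    (1# + x) - (x + 1#)            ≈⟨ +-congʳ (+-comm 1# x) ⟩
    (x + 1#) - (x + 1#)            ≈⟨ -‿inverseʳ (x + 1#) ⟩
    0#                             ∎

  x*x≈1⇒x≈±1 : ∀ {x} → x * x ≈ 1# → x ≈ 1# ⊎ x ≈ - 1#
  x*x≈1⇒x≈±1 {x} x*x≈1 = case (x + 1#) ≟ 0# of λ where
    (yes x+1≈0) → inj₂ (+-inverseˡ-unique x 1# x+1≈0)
    (no x+1≉0)  → inj₁ (x∙y⁻¹≈ε⇒x≈y x 1# (x≉0∧xy≈0⇒y≈0 x+1≉0 (x*x≈1⇒[x+1][x-1]≈0 x*x≈1)))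

  index : Carrier → Fin q
  index x = proj₁ (enum-surj x)

  enum-index : ∀ x → enum (index x) ≈ x
  enum-index x = proj₂ (enum-surj x)

  index-cong : ∀ {x y} → x ≈ y → index x ≡ index y
  index-cong {x} {y} x≈y = enum-inj _ _ (trans (enum-index x) (trans x≈y (sym (enum-index y))))

  index-enum : ∀ i → index (enum i) ≡ i
  index-enum i = enum-inj _ _ (enum-index (enum i))

  enum≈⇒≡index : ∀ {i x} → enum i ≈ x → i ≡ index x
  enum≈⇒≡index {i} e = ≡.trans (≡.sym (index-enum i)) (index-cong e)

  onIndices : (Carrier → Carrier) → Fin q → Fin q
  onIndices f i = index (f (enum i))

  onIndices-involutive : ∀ {f} → Congruent₁ f → Involutive f → ∀ i → onIndices f (onIndices f i) ≡ i
  onIndices-involutive {f} f-cong f-involutive i =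
    ≡.trans (index-cong (trans (f-cong (enum-index (f (enum i)))) (f-involutive (enum i)))) (index-enum i)

  onIndices-commute : ∀ {f g} → Congruent₁ f → Congruent₁ g → (∀ x → f (g x) ≈ g (f x)) →
    ∀ i → onIndices f (onIndices g i) ≡ onIndices g (onIndices f i)
  onIndices-commute {f} {g} f-cong g-cong fg≈gf i = index-cong (begin
    f (enum (index (g (enum i))))  ≈⟨ f-cong (enum-index (g (enum i))) ⟩
    f (g (enum i))                 ≈⟨ fg≈gf (enum i) ⟩
    g (f (enum i))                 ≈⟨ g-cong (enum-index (f (enum i))) ⟨
    g (enum (index (f (enum i))))  ∎)

  onIndices-fixed : ∀ f i → onIndices f i ≡ i → f (enum i) ≈ enum i
  onIndices-fixed f i fixed = trans (sym (enum-index (f (enum i)))) (reflexive (≡.cong enum fixed))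

  onIndices-fixed⁻¹ : ∀ f i → f (enum i) ≈ enum i → onIndices f i ≡ i
  onIndices-fixed⁻¹ f i f-fixed = ≡.sym (enum≈⇒≡index (sym f-fixed))

  -- A field with 1 + 1 = 0 has even size: x ↦ x + 1 is a fixed-point-free involution.
  1+1≉0 : q % 2 ≡ 1 → 1# + 1# ≉ 0#
  1+1≉0 q-odd 1+1≈0 with Involution.size-even (onIndices (_+ 1#)) (onIndices-involutive +-congʳ +1+1≈id) moved
    where
    +1+1≈id : Involutive (_+ 1#)
    +1+1≈id x = trans (+-assoc x 1# 1#) (trans (+-congˡ 1+1≈0) (+-identityʳ x))
    moved : ∀ i → onIndices (_+ 1#) i ≢ i
    moved i fixed = 1≉0 (+-cancelˡ (enum i) 1# 0#
      (trans (onIndices-fixed (_+ 1#) i fixed) (sym (+-identityʳ (enum i)))))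
  ... | m , q≡m*2 with () ← ≡.trans (≡.sym q-odd) (≡.trans (≡.cong (_% 2) q≡m*2) (m*n%n≡0 m 2))

  -x≈x⇒x≈0 : 1# + 1# ≉ 0# → ∀ {x} → - x ≈ x → x ≈ 0#
  -x≈x⇒x≈0 1+1≉0 {x} -x≈x = x≉0∧xy≈0⇒y≈0 1+1≉0 (begin
    (1# + 1#) * x       ≈⟨ distribʳ x 1# 1# ⟩
    1# * x + 1# * x     ≈⟨ +-cong (*-identityˡ x) (trans (*-identityˡ x) (sym -x≈x)) ⟩
    x + - x             ≈⟨ -‿inverseʳ x ⟩
    0#                  ∎)

  neg inv : Fin q → Fin q
  neg = onIndices (-_)
  inv = onIndices _⁻¹

  neg-involutive : ∀ i → neg (neg i) ≡ i
  neg-involutive = onIndices-involutive -‿cong -‿involutive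

  inv-involutive : ∀ i → inv (inv i) ≡ i
  inv-involutive = onIndices-involutive ⁻¹-cong ⁻¹-involutive

  neg-inv-commute : ∀ i → neg (inv i) ≡ inv (neg i)
  neg-inv-commute = onIndices-commute -‿cong ⁻¹-cong (λ x → sym (-‿⁻¹ x))

  neg-0 : neg (index 0#) ≡ index 0#
  neg-0 = index-cong (trans (-‿cong (enum-index 0#)) -0#≈0#)

  neg-moved⇒≉0 : ∀ {i} → neg i ≢ i → enum i ≉ 0#
  neg-moved⇒≉0 {i} moved x≈0 = moved (onIndices-fixed⁻¹ (-_) i (trans (-‿cong x≈0) (trans -0#≈0# (sym x≈0))))

  inv-1 : inv (index 1#) ≡ index 1#
  inv-1 = index-cong (trans (⁻¹-cong (enum-index 1#)) (sym (inverse-unique (*-identityˡ 1#))))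

  inv-fixed⇒±1 : ∀ i → neg i ≢ i → inv i ≡ i → i ≡ index 1# ⊎ i ≡ neg (index 1#)
  inv-fixed⇒±1 i moved fixed with x*x≈1⇒x≈±1 x*x≈1
    where
    x*x≈1 : enum i * enum i ≈ 1#
    x*x≈1 = trans (*-congˡ (sym (onIndices-fixed _⁻¹ i fixed))) (⁻¹-inverseʳ (neg-moved⇒≉0 moved))
  ... | inj₁ x≈1  = inj₁ (enum≈⇒≡index x≈1)
  ... | inj₂ x≈-1 = inj₂ (enum≈⇒≡index (trans x≈-1 (-‿cong (sym (enum-index 1#)))))

  neg-fixed⇒0 : 1# + 1# ≉ 0# → ∀ i → neg i ≡ i → i ≡ index 0#
  neg-fixed⇒0 1+1≉0 i fixed = enum≈⇒≡index (-x≈x⇒x≈0 1+1≉0 (onIndices-fixed (-_) i fixed))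

  neg-1≢1 : 1# + 1# ≉ 0# → neg (index 1#) ≢ index 1#
  neg-1≢1 1+1≉0 fixed = 1≉0 (trans (sym (enum-index 1#)) (-x≈x⇒x≈0 1+1≉0 (onIndices-fixed (-_) (index 1#) fixed)))

  no-√-1⇒q%4≡3 : q % 2 ≡ 1 → (∀ x → x * x ≉ - 1#) → q % 4 ≡ 3
  no-√-1⇒q%4≡3 q-odd no-root = mod-4 (CommutingInvolutions.size≡3-mod-4 neg inv
    neg-involutive inv-involutive neg-inv-commute (index 0#) (index 1#)
    neg-0 (neg-fixed⇒0 (1+1≉0 q-odd)) (neg-1≢1 (1+1≉0 q-odd)) inv-1 inv-fixed⇒±1 neg-inv-moved)
    where
    mod-4 : ∃[ m ] q ≡ 3 ℕ.+ m ℕ.* 4 → q % 4 ≡ 3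
    mod-4 (m , q≡3+m*4) = ≡.trans (≡.cong (_% 4) q≡3+m*4) ([m+kn]%n≡m%n 3 m 4)

    neg-inv-moved : ∀ i → neg i ≢ i → neg (inv i) ≢ i
    neg-inv-moved i moved fixed = no-root x (begin
      x * x                   ≈⟨ *-congˡ (reflexive (≡.cong enum fixed)) ⟨
      x * enum (neg (inv i))  ≈⟨ *-congˡ (trans (enum-index _) (-‿cong (enum-index (x ⁻¹)))) ⟩
      x * - (x ⁻¹)            ≈⟨ -‿distribʳ-* x (x ⁻¹) ⟨
      - (x * x ⁻¹)            ≈⟨ -‿cong (⁻¹-inverseʳ (neg-moved⇒≉0 moved)) ⟩
      - 1#                    ∎)
      where x = enum i

  -1-isSquare : q % 2 ≡ 1 → q % 4 ≡ 1 → ∃[ s ] s * s ≈ - 1#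
  -1-isSquare q-odd q%4≡1 = case any? (λ i → (enum i * enum i) ≟ (- 1#)) of λ where
    (yes (i , i²≈-1)) → enum i , i²≈-1
    (no no-root)      → contradiction (≡.trans (≡.sym q%4≡1) (no-√-1⇒q%4≡3 q-odd λ x x²≈-1 →
                          no-root (index x , trans (*-cong (enum-index x) (enum-index x)) x²≈-1))) λ ()

module CoveredPoint {c ℓ : Level} {q : ℕ} (F : FiniteField c ℓ q) where

  open import Data.Product using (proj₁; proj₂)
  open import Data.Sum using (inj₁; inj₂)
  open FiniteField F
  open FiniteFieldFacts F using (x≉0∧xy≈0⇒y≈0; -x*-y≈x*y)
  open Projective F
  open import Algebra.Properties.Ring ring using (-0#≈0#)
  open import Relation.Binary.Reasoning.Setoid setoid

  e₃ : Triple
  e₃ = (0# , 0# , 1#)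

  det-e₃ : ∀ a₁ a₂ a₃ b₁ b₂ b₃ → det (a₁ , a₂ , a₃) (b₁ , b₂ , b₃) e₃ ≈ a₁ * b₂ - a₂ * b₁
  det-e₃ a₁ a₂ a₃ b₁ b₂ b₃ = begin
    a₁ * (b₂ * 1# - b₃ * 0#) - a₂ * (b₁ * 1# - b₃ * 0#) + a₃ * (b₁ * 0# - b₂ * 0#)
      ≈⟨ +-cong (+-cong (*-congˡ (minor b₂)) (-‿cong (*-congˡ (minor b₁))))
                (trans (*-congˡ zero-minor) (zeroʳ a₃)) ⟩
    a₁ * b₂ - a₂ * b₁ + 0#  ≈⟨ +-identityʳ _ ⟩
    a₁ * b₂ - a₂ * b₁       ∎
    where
    minor : ∀ b → b * 1# - b₃ * 0# ≈ b
    minor b = trans (+-cong (*-identityʳ b) (trans (-‿cong (zeroʳ b₃)) -0#≈0#)) (+-identityʳ b)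
    zero-minor : b₁ * 0# - b₂ * 0# ≈ 0#
    zero-minor = trans (+-cong (zeroʳ b₁) (-‿cong (zeroʳ b₂))) (-‿inverseʳ 0#)

  e₃-nonzero : NonZero₃ e₃
  e₃-nonzero (_ , _ , 1≈0) = 1≉0 1≈0

  e₃∉H : ¬ (e₃ ∈P H)
  e₃∉H (_ , (_ , x≈1 , _) , (t , t≉0 , 0≈t*x , _)) =
    t≉0 (trans (sym (*-identityʳ t)) (sym (trans 0≈t*x (*-congˡ x≈1))))

  e₃∉K : ∀ a₀ b₀ → ¬ (e₃ ∈P K (a₀ , b₀ , 0#))
  e₃∉K a₀ b₀ (A , inj₁ A∈H , same) = e₃∉H (A , A∈H , same)
  e₃∉K a₀ b₀ (_ , inj₂ (_ , _ , z≈0) , (t , _ , _ , _ , 1≈t*z)) =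
    1≉0 (trans 1≈t*z (trans (*-congˡ z≈0) (zeroʳ t)))

  e₃-H-covered : ∀ s → s * s ≈ - 1# → 1# + 1# ≉ 0# → Covered H e₃
  e₃-H-covered s s²≈-1 1+1≉0 =
    e₃-nonzero , e₃∉H , A , B , (s , refl , refl , refl) , (1# , refl , refl , refl) , A≠B , collinear
    where
    A B : Triple
    A = (1# , sq (sq s) , sq s)
    B = (1# , sq (sq 1#) , sq 1#)
    s⁴≈1 : sq (sq s) ≈ 1#
    s⁴≈1 = trans (*-cong s²≈-1 s²≈-1) (trans (-x*-y≈x*y 1# 1#) (*-identityˡ 1#))
    1⁴≈1 : sq (sq 1#) ≈ 1#
    1⁴≈1 = trans (*-cong (*-identityˡ 1#) (*-identityˡ 1#)) (*-identityˡ 1#)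
    A≠B : ¬ SamePoint A B
    A≠B (t , _ , 1≈t*1 , _ , 1²≈t*s²) = 1+1≉0 (begin
      1# + 1#             ≈⟨ +-congʳ (*-identityˡ 1#) ⟨
      1# * 1# + 1#        ≈⟨ +-congʳ 1²≈t*s² ⟩
      t * (s * s) + 1#    ≈⟨ +-congʳ (*-cong t≈1 s²≈-1) ⟩
      1# * - 1# + 1#      ≈⟨ +-congʳ (*-identityˡ (- 1#)) ⟩
      - 1# + 1#           ≈⟨ -‿inverseˡ 1# ⟩
      0#                  ∎)
      where t≈1 = trans (sym (*-identityʳ t)) (sym 1≈t*1)
    collinear : Collinear A B e₃
    collinear = trans (det-e₃ 1# (sq (sq s)) (sq s) 1# (sq (sq 1#)) (sq 1#))
      (trans (+-cong (trans (*-identityˡ _) 1⁴≈1) (-‿cong (trans (*-identityʳ _) s⁴≈1))) (-‿inverseʳ 1#))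

  x*[y/x]≈y : ∀ {x} y (x≉0 : x ≉ 0#) → x * div y x x≉0 ≈ y
  x*[y/x]≈y {x} y x≉0 = begin
    x * (y * x′)   ≈⟨ *-assoc x y x′ ⟨
    (x * y) * x′   ≈⟨ *-congʳ (*-comm x y) ⟩
    (y * x) * x′   ≈⟨ *-assoc y x x′ ⟩
    y * (x * x′)   ≈⟨ *-congˡ (proj₂ (inverse x x≉0)) ⟩
    y * 1#         ≈⟨ *-identityʳ y ⟩
    y              ∎
    where x′ = proj₁ (inverse x x≉0)

  e₃-K-covered : ∀ a₀ b₀ u (a₀≉0 : a₀ ≉ 0#) → u ≉ 0# → div b₀ a₀ a₀≉0 ≈ sq (sq u) →
    Covered (K (a₀ , b₀ , 0#)) e₃
  e₃-K-covered a₀ b₀ u a₀≉0 u≉0 b₀/a₀≈u⁴ =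
    e₃-nonzero , e₃∉K a₀ b₀ , A , B , inj₂ (refl , refl , refl) , inj₁ (u , refl , refl , refl) , A≠B , collinear
    where
    A B : Triple
    A = (a₀ , b₀ , 0#)
    B = (1# , sq (sq u) , sq u)
    A≠B : ¬ SamePoint A B
    A≠B (t , _ , _ , _ , u²≈t*0) = u≉0 (x≉0∧xy≈0⇒y≈0 u≉0 (trans u²≈t*0 (zeroʳ t)))
    collinear : Collinear A B e₃
    collinear = begin
      det A B e₃                 ≈⟨ det-e₃ a₀ b₀ 0# 1# (sq (sq u)) (sq u) ⟩
      a₀ * sq (sq u) - b₀ * 1#   ≈⟨ +-cong (*-congˡ b₀/a₀≈u⁴) (-‿cong (sym (*-identityʳ b₀))) ⟨
      a₀ * div b₀ a₀ a₀≉0 - b₀   ≈⟨ +-congʳ (x*[y/x]≈y b₀ a₀≉0) ⟩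
      b₀ - b₀                    ≈⟨ -‿inverseʳ b₀ ⟩
      0#                         ∎

lemma3p7 : {c ℓ : Level} (q : ℕ) → OddPrimePower q → (F : FiniteField c ℓ q) →
  let open FiniteField F
      open Projective F
  in (a₀ b₀ : Carrier) → (a₀≉0 : ¬ (a₀ ≈ 0#)) → ¬ (b₀ ≈ 0#) →
    (q % 4 ≡ 1 → Covered H (0# , 0# , 1#)) ×
    (q % 4 ≡ 3 →
      (Σ Carrier λ u → ¬ (u ≈ 0#) × div b₀ a₀ a₀≉0 ≈ sq (sq u)) →
      Covered (K (a₀ , b₀ , 0#)) (0# , 0# , 1#))
lemma3p7 q (_ , _ , _ , _ , q-odd) F a₀ b₀ a₀≉0 _ =
  (λ q%4≡1 → let (s , s²≈-1) = -1-isSquare q-odd q%4≡1 in e₃-H-covered s s²≈-1 (1+1≉0 q-odd)) ,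
  (λ _ (u , u≉0 , b₀/a₀≈u⁴) → e₃-K-covered a₀ b₀ u a₀≉0 u≉0 b₀/a₀≈u⁴)
  where
  open FiniteFieldFacts F using (1+1≉0; -1-isSquare)
  open CoveredPoint F
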